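{- Let $G$ be a finite graph, $S$ an independent set of $G$, $k$ an integer, and $M$ a module of $G$. Suppose there exists an independent set $A\subseteq M$ such that $S\cap M\subseteq A$ and $|A|=\alpha(G[M])$. Then for every $u\in M\setminus A$ we have $\lambda(G,S,k)=\lambda(G-u,S,k)$.
   Context: For a graph $G$, independent sets $S,S'$ and an integer $k$, write $S\leftrightarrow_k S'$ if $|S\triangle S'|\le 1$ and $\min\{|S|,|S'|\}\ge k$. Write $S\leftrightsquigarrow_k S'$ if there exist $\ell\ge 0$ and independent sets $S_0=S,S_1,\dots,S_\ell=S'$ of $G$ with $S_{i-1}\leftrightarrow_k S_i$ for all $i\in\{1,\dots,\ell\}$. $\lambda(G,S,k)$ denotes the largest size of an independent set $S'$ of $G$ with $S\leftrightsquigarrow_k S'$ (reconfiguration taking place in $G$). A module of $G=(V,E)$ is a set $M\subseteq V$ such that for all $u,v\in M$ and $w\in V\setminus M$, if $\{u,w\}\in E$ then $\{v,w\}\in E$. $\alpha(H)$ is the size of a maximum independent set of $H$; $G[M]$ is the induced subgraph and $G-u$ is $G$ with $u$ deleted. -}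

module Defs where

open import Data.Nat using (ℕ; _≤_)
open import Data.Integer using (ℤ; +_) renaming (_≤_ to _≤ℤ_)
open import Data.Bool using (Bool; true; false)
open import Data.Fin using (Fin)
open import Data.Fin.Subset using (Subset; _∈_; _∉_; _⊆_; _∩_; _∪_; _─_; _-_; ∣_∣)
open import Data.Product using (Σ; _×_; ∃)
open import Data.Empty using (⊥)
open import Relation.Binary.PropositionalEquality using (_≡_)
open import Relation.Nullary using (¬_)
open import Function.Bundles using (_⇔_)

-- A finite simple graph whose vertex set is a subset V of an ambient
-- finite set Fin n (so that induced subgraphs / vertex deletions are again
-- graphs of the same kind).  Adjacency is a symmetric, irreflexive
-- Bool-valued relation; adjacency involving vertices outside V is ignored.
record Graph (n : ℕ) : Set where
  field
    V     : Subset n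
    adj   : Fin n → Fin n → Bool
    sym   : ∀ x y → adj x y ≡ adj y x
    irrefl : ∀ x → adj x x ≡ false

open Graph public

module _ {n : ℕ} where

  Edge : Graph n → Fin n → Fin n → Set
  Edge G x y = x ∈ V G × y ∈ V G × adj G x y ≡ true

  induced : Graph n → Subset n → Graph n
  induced G M = record { V = V G ∩ M ; adj = adj G ; sym = sym G ; irrefl = irrefl G }

  delete : Graph n → Fin n → Graph n
  delete G u = record { V = V G - u ; adj = adj G ; sym = sym G ; irrefl = irrefl G }

  Independent : Graph n → Subset n → Set
  Independent G S = S ⊆ V G × (∀ {x y} → x ∈ S → y ∈ S → ¬ Edge G x y)

  IsAlpha : Graph n → ℕ → Set
  IsAlpha H a = (Σ (Subset n) λ B → Independent H B × ∣ B ∣ ≡ a)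
              × (∀ B → Independent H B → ∣ B ∣ ≤ a)

  IsModule : Graph n → Subset n → Set
  IsModule G M = M ⊆ V G × (∀ {u v w} → u ∈ M → v ∈ M → w ∈ V G → w ∉ M →
                             Edge G u w → Edge G v w)

  symDiff : Subset n → Subset n → Subset n
  symDiff S T = (S ─ T) ∪ (T ─ S)

  Step : Graph n → ℤ → Subset n → Subset n → Set
  Step G k S S' = Independent G S × Independent G S'
                × ∣ symDiff S S' ∣ ≤ 1 × k ≤ℤ + ∣ S ∣ × k ≤ℤ + ∣ S' ∣

  data Reach (G : Graph n) (k : ℤ) (S : Subset n) : Subset n → Set where
    here : Reach G k S S
    step : ∀ {T T'} → Reach G k S T → Step G k T T' → Reach G k S T'

  IsLambda : Graph n → Subset n → ℤ → ℕ → Set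
  IsLambda G S k m = (Σ (Subset n) λ S' → Independent G S' × Reach G k S S' × ∣ S' ∣ ≡ m)
                   × (∀ S' → Independent G S' → Reach G k S S' → ∣ S' ∣ ≤ m)

module Submission where

-- Every set reachable in G - u is reachable in G, so only one
-- direction needs an argument: a reconfiguration sequence S = T₀, T₁, …
-- in G is shadowed by a sequence S = T₀', T₁', … in G - u such that each
-- Tᵢ' agrees with Tᵢ outside M, has as many vertices in M as Tᵢ, and
-- meets M only inside A ("Tᵢ' matches Tᵢ").  A matching set has the size
-- of the set it matches and, M being a module, is independent in G - u.
-- When Tᵢ toggles a vertex x ∉ M, Tᵢ' toggles x as well; when it removes
-- a vertex of M, Tᵢ' removes one of its own vertices in M; when it adds a
-- vertex of M, Tᵢ ∩ M grows to an independent set of G[M], so it was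
-- smaller than α(G[M]) = ∣ A ∣ and Tᵢ' can add a vertex of A.

open import Defs
open import Data.Nat using (ℕ; suc; _+_; _≤_; _<_; s≤s)
open import Data.Nat.Properties using (suc-injective; ≤-reflexive; +-suc; n≤0⇒n≡0; <⇒≱; module ≤-Reasoning)
open import Data.Integer using (ℤ; +_) renaming (_≤_ to _≤ℤ_)
open import Data.Bool using (true; false; not)
open import Data.Fin using (Fin; zero; suc)
open import Data.Fin.Properties using (any?)
open import Data.Fin.Subset
  using (Subset; _∈_; _∉_; _⊆_; _∩_; _─_; _-_; ∣_∣; Nonempty)
open import Data.Fin.Subset.Properties
  using (_∈?_; x∈p∩q⁺; x∈p∩q⁻; x∈p∧x∉q⇒x∈p─q; p─q⊆p; x∈p∧x≢y⇒x∈p-y;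
         p⊆q⇒∣p∣≤∣q∣; nonempty?; Empty-unique; ∣⊥∣≡0)
open import Data.Vec using ([]; _∷_; here; there; updateAt)
open import Data.Product using (_×_; ∃; _,_; proj₁; proj₂)
open import Data.Sum using (_⊎_; inj₁; inj₂)
open import Data.Empty using (⊥-elim)
open import Relation.Binary.PropositionalEquality
  using (_≡_; refl; cong; cong₂; trans; subst; module ≡-Reasoning) renaming (sym to ≡-sym)
open import Relation.Nullary using (¬_; yes; no; contradiction)
open import Relation.Nullary.Decidable using (_×-dec_; ¬?)
open import Function.Bundles using (_⇔_; mk⇔)

toggle : ∀ {n} → Fin n → Subset n → Subset n
toggle x p = updateAt p x not

toggle-∈⁻ : ∀ {n} {x y : Fin n} {p} → y ∈ toggle x p → y ≡ x ⊎ y ∈ p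
toggle-∈⁻ {_} {zero}  {zero}  {b ∷ p} _         = inj₁ refl
toggle-∈⁻ {_} {zero}  {suc y} {b ∷ p} (there h) = inj₂ (there h)
toggle-∈⁻ {_} {suc x} {zero}  {b ∷ p} here      = inj₂ here
toggle-∈⁻ {_} {suc x} {suc y} {b ∷ p} (there h) with toggle-∈⁻ {x = x} h
... | inj₁ y≡x = inj₁ (cong suc y≡x)
... | inj₂ y∈p = inj₂ (there y∈p)

toggle-⊆ : ∀ {n} {x : Fin n} {p A} → x ∈ A → p ⊆ A → toggle x p ⊆ A
toggle-⊆ {x = x} x∈A p⊆A y∈ with toggle-∈⁻ {x = x} y∈
... | inj₁ refl = x∈A
... | inj₂ y∈p  = p⊆A y∈p

toggle-card-∈ : ∀ {n} {x : Fin n} {p} → x ∈ p → suc ∣ toggle x p ∣ ≡ ∣ p ∣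
toggle-card-∈ {_} {zero}  {true ∷ p}  here      = refl
toggle-card-∈ {_} {suc x} {true ∷ p}  (there h) = cong suc (toggle-card-∈ h)
toggle-card-∈ {_} {suc x} {false ∷ p} (there h) = toggle-card-∈ h

toggle-card-∉ : ∀ {n} {x : Fin n} {p} → x ∉ p → ∣ toggle x p ∣ ≡ suc ∣ p ∣
toggle-card-∉ {_} {zero}  {true ∷ p}  h = ⊥-elim (h here)
toggle-card-∉ {_} {zero}  {false ∷ p} h = refl
toggle-card-∉ {_} {suc x} {true ∷ p}  h = cong suc (toggle-card-∉ (λ z → h (there z)))
toggle-card-∉ {_} {suc x} {false ∷ p} h = toggle-card-∉ (λ z → h (there z))

toggle-card-cong : ∀ {n} {x y : Fin n} {p q} → ∣ p ∣ ≡ ∣ q ∣ →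
                   (x ∈ p × y ∈ q) ⊎ (x ∉ p × y ∉ q) →
                   ∣ toggle x p ∣ ≡ ∣ toggle y q ∣
toggle-card-cong eq (inj₁ (x∈p , y∈q)) =
  suc-injective (trans (toggle-card-∈ x∈p) (trans eq (≡-sym (toggle-card-∈ y∈q))))
toggle-card-cong eq (inj₂ (x∉p , y∉q)) =
  trans (toggle-card-∉ x∉p) (trans (cong suc eq) (≡-sym (toggle-card-∉ y∉q)))

symDiff-self : ∀ {n} (p : Subset n) → ∣ symDiff p p ∣ ≡ 0
symDiff-self []          = refl
symDiff-self (true ∷ p)  = symDiff-self p
symDiff-self (false ∷ p) = symDiff-self p

symDiff-toggle : ∀ {n} (x : Fin n) p → ∣ symDiff p (toggle x p) ∣ ≡ 1
symDiff-toggle zero    (true ∷ p)  = cong suc (symDiff-self p)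
symDiff-toggle zero    (false ∷ p) = cong suc (symDiff-self p)
symDiff-toggle (suc x) (true ∷ p)  = symDiff-toggle x p
symDiff-toggle (suc x) (false ∷ p) = symDiff-toggle x p

symDiff-empty : ∀ {n} (p q : Subset n) → ∣ symDiff p q ∣ ≡ 0 → p ≡ q
symDiff-empty []          []          _ = refl
symDiff-empty (true ∷ p)  (true ∷ q)  h = cong (true ∷_) (symDiff-empty p q h)
symDiff-empty (false ∷ p) (false ∷ q) h = cong (false ∷_) (symDiff-empty p q h)
symDiff-empty (true ∷ p)  (false ∷ q) ()
symDiff-empty (false ∷ p) (true ∷ q)  ()

AtMostOneToggle : ∀ {n} → Subset n → Subset n → Set
AtMostOneToggle p q = p ≡ q ⊎ ∃ λ x → q ≡ toggle x p

∷-toggle : ∀ {n} {p q : Subset n} b → AtMostOneToggle p q → AtMostOneToggle (b ∷ p) (b ∷ q)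
∷-toggle b (inj₁ refl)       = inj₁ refl
∷-toggle b (inj₂ (x , refl)) = inj₂ (suc x , refl)

single-toggle : ∀ {n} (p q : Subset n) → ∣ symDiff p q ∣ ≤ 1 → AtMostOneToggle p q
single-toggle []          []          _       = inj₁ refl
single-toggle (true ∷ p)  (true ∷ q)  h       = ∷-toggle true (single-toggle p q h)
single-toggle (false ∷ p) (false ∷ q) h       = ∷-toggle false (single-toggle p q h)
single-toggle (true ∷ p)  (false ∷ q) (s≤s h) =
  inj₂ (zero , cong (false ∷_) (≡-sym (symDiff-empty p q (n≤0⇒n≡0 h))))
single-toggle (false ∷ p) (true ∷ q)  (s≤s h) =
  inj₂ (zero , cong (true ∷_) (≡-sym (symDiff-empty p q (n≤0⇒n≡0 h))))

toggle-∩-∈ : ∀ {n} {x : Fin n} {T M} → x ∈ M → toggle x T ∩ M ≡ toggle x (T ∩ M)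
toggle-∩-∈ {_} {zero}  {true ∷ T}  {true ∷ M} here      = refl
toggle-∩-∈ {_} {zero}  {false ∷ T} {true ∷ M} here      = refl
toggle-∩-∈ {_} {suc x} {b ∷ T}     {c ∷ M}    (there h) = cong (_ ∷_) (toggle-∩-∈ h)

toggle-∩-∉ : ∀ {n} {x : Fin n} {T M} → x ∉ M → toggle x T ∩ M ≡ T ∩ M
toggle-∩-∉ {_} {zero}  {b ∷ T}     {true ∷ M}  h = ⊥-elim (h here)
toggle-∩-∉ {_} {zero}  {true ∷ T}  {false ∷ M} h = refl
toggle-∩-∉ {_} {zero}  {false ∷ T} {false ∷ M} h = refl
toggle-∩-∉ {_} {suc x} {b ∷ T}     {c ∷ M}     h = cong (_ ∷_) (toggle-∩-∉ (λ z → h (there z)))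

toggle-─-∈ : ∀ {n} {x : Fin n} {T M} → x ∈ M → toggle x T ─ M ≡ T ─ M
toggle-─-∈ {_} {zero}  {true ∷ T}  {true ∷ M}  here      = refl
toggle-─-∈ {_} {zero}  {false ∷ T} {true ∷ M}  here      = refl
toggle-─-∈ {_} {suc x} {b ∷ T}     {true ∷ M}  (there h) = cong (false ∷_) (toggle-─-∈ h)
toggle-─-∈ {_} {suc x} {b ∷ T}     {false ∷ M} (there h) = cong (b ∷_) (toggle-─-∈ h)

toggle-─-∉ : ∀ {n} {x : Fin n} {T M} → x ∉ M → toggle x T ─ M ≡ toggle x (T ─ M)
toggle-─-∉ {_} {zero}  {b ∷ T}     {true ∷ M}  h = ⊥-elim (h here)
toggle-─-∉ {_} {zero}  {true ∷ T}  {false ∷ M} h = refl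
toggle-─-∉ {_} {zero}  {false ∷ T} {false ∷ M} h = refl
toggle-─-∉ {_} {suc x} {b ∷ T}     {true ∷ M}  h = cong (false ∷_) (toggle-─-∉ (λ z → h (there z)))
toggle-─-∉ {_} {suc x} {b ∷ T}     {false ∷ M} h = cong (b ∷_) (toggle-─-∉ (λ z → h (there z)))

∣∣-split : ∀ {n} (T M : Subset n) → ∣ T ∣ ≡ ∣ T ∩ M ∣ + ∣ T ─ M ∣
∣∣-split []          []          = refl
∣∣-split (true ∷ T)  (true ∷ M)  = cong suc (∣∣-split T M)
∣∣-split (true ∷ T)  (false ∷ M) = trans (cong suc (∣∣-split T M)) (≡-sym (+-suc _ _))
∣∣-split (false ∷ T) (true ∷ M)  = ∣∣-split T M
∣∣-split (false ∷ T) (false ∷ M) = ∣∣-split T M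

nonempty-transfer : ∀ {n} {p q : Subset n} {x} → ∣ p ∣ ≡ ∣ q ∣ → x ∈ p → Nonempty q
nonempty-transfer {n} {p} {q} ∣p∣≡∣q∣ x∈p with nonempty? q
... | yes ne   = ne
... | no empty = contradiction (trans (toggle-card-∈ x∈p) (trans ∣p∣≡∣q∣ ∣q∣≡0)) λ ()
  where
  ∣q∣≡0 : ∣ q ∣ ≡ 0
  ∣q∣≡0 = trans (cong ∣_∣ (Empty-unique empty)) (∣⊥∣≡0 n)

missing-element : ∀ {n} {X A : Subset n} → ∣ X ∣ < ∣ A ∣ → ∃ λ a → a ∈ A × a ∉ X
missing-element {X = X} {A} ∣X∣<∣A∣ with any? (λ a → a ∈? A ×-dec ¬? (a ∈? X))
... | yes found = found
... | no none   = contradiction (p⊆q⇒∣p∣≤∣q∣ A⊆X) (<⇒≱ ∣X∣<∣A∣)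
  where
  A⊆X : A ⊆ X
  A⊆X {a} a∈A with a ∈? X
  ... | yes a∈X = a∈X
  ... | no  a∉X = contradiction (a , a∈A , a∉X) none

edge-sym : ∀ {n} (G : Graph n) {x y} → Edge G x y → Edge G y x
edge-sym G {x} {y} (x∈V , y∈V , e) = y∈V , x∈V , trans (Graph.sym G y x) e

induced-independent : ∀ {n} (G : Graph n) (M : Subset n) {T} →
                      Independent G T → Independent (induced G M) (T ∩ M)
induced-independent G M {T} (T⊆V , noEdge) = ⊆-restrict , noEdge-restrict
  where
  ⊆-restrict : T ∩ M ⊆ V G ∩ M
  ⊆-restrict y∈ = let (y∈T , y∈M) = x∈p∩q⁻ T M y∈ in x∈p∩q⁺ (T⊆V y∈T , y∈M)
  noEdge-restrict : ∀ {y z} → y ∈ T ∩ M → z ∈ T ∩ M → ¬ Edge (induced G M) y z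
  noEdge-restrict y∈ z∈ (y∈V , z∈V , e) =
    noEdge (proj₁ (x∈p∩q⁻ T M y∈)) (proj₁ (x∈p∩q⁻ T M z∈))
           (proj₁ (x∈p∩q⁻ (V G) M y∈V) , proj₁ (x∈p∩q⁻ (V G) M z∈V) , e)

delete-edge : ∀ {n} (G : Graph n) u {x y} → Edge (delete G u) x y → Edge G x y
delete-edge G u (x∈V , y∈V , e) = p─q⊆p _ _ x∈V , p─q⊆p _ _ y∈V , e

delete-independent : ∀ {n} (G : Graph n) u {T} → Independent (delete G u) T → Independent G T
delete-independent G u (T⊆V , noEdge) =
  (λ y∈T → p─q⊆p _ _ (T⊆V y∈T)) ,
  λ y∈T z∈T (_ , _ , e) → noEdge y∈T z∈T (T⊆V y∈T , T⊆V z∈T , e)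

delete-reach : ∀ {n} (G : Graph n) u {k S T} → Reach (delete G u) k S T → Reach G k S T
delete-reach G u here = here
delete-reach G u (step r (iT , iT' , sd , k≤T , k≤T')) =
  step (delete-reach G u r)
       (delete-independent G u iT , delete-independent G u iT' , sd , k≤T , k≤T')

lambda-transfer : ∀ {n} (G H : Graph n) (S : Subset n) (k : ℤ) (m : ℕ) →
  (∀ {T} → Independent H T → Reach H k S T → Independent G T × Reach G k S T) →
  (∀ {T} → Independent G T → Reach G k S T →
     ∃ λ T' → Independent H T' × Reach H k S T' × ∣ T' ∣ ≡ ∣ T ∣) →
  IsLambda G S k m ⇔ IsLambda H S k m
lambda-transfer G H S k m down up = mk⇔ to from
  where
  to : IsLambda G S k m → IsLambda H S k m
  to ((T , iT , r , ∣T∣≡m) , max) =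
    let (T' , iT' , r' , same) = up iT r in
    (T' , iT' , r' , trans same ∣T∣≡m) ,
    λ T'' iT'' r'' → let (iG , rG) = down iT'' r'' in max T'' iG rG
  from : IsLambda H S k m → IsLambda G S k m
  from ((T , iT , r , ∣T∣≡m) , max) =
    let (iG , rG) = down iT r in
    (T , iG , rG , ∣T∣≡m) ,
    λ T'' iT'' r'' → let (T' , iT' , r' , same) = up iT'' r'' in
                     subst (_≤ m) same (max T' iT' r')

record Matches {n} (M A T T' : Subset n) : Set where
  field
    inside-A      : T' ∩ M ⊆ A
    same-outside  : T' ─ M ≡ T ─ M
    same-count-in : ∣ T' ∩ M ∣ ≡ ∣ T ∩ M ∣

module Matching {n} {M A : Subset n} where
  open Matches

  matches-size : ∀ {T T'} → Matches M A T T' → ∣ T' ∣ ≡ ∣ T ∣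
  matches-size {T} {T'} m = trans (∣∣-split T' M)
    (trans (cong₂ _+_ (same-count-in m) (cong ∣_∣ (same-outside m))) (≡-sym (∣∣-split T M)))

  matches-∉ : ∀ {T T' y} → Matches M A T T' → y ∈ T' → y ∉ M → y ∈ T
  matches-∉ {T} m y∈T' y∉M =
    p─q⊆p T M (subst (_ ∈_) (same-outside m) (x∈p∧x∉q⇒x∈p─q y∈T' y∉M))

  matches-∈ : ∀ {T T' y} → Matches M A T T' → y ∈ T' → y ∈ M → y ∈ A
  matches-∈ m y∈T' y∈M = inside-A m (x∈p∩q⁺ (y∈T' , y∈M))

  matches-refl : ∀ {T} → T ∩ M ⊆ A → Matches M A T T
  matches-refl T∩M⊆A = record { inside-A = T∩M⊆A ; same-outside = refl ; same-count-in = refl }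

  matches-toggle-∉ : ∀ {T T' x} → x ∉ M → Matches M A T T' →
                     Matches M A (toggle x T) (toggle x T')
  matches-toggle-∉ {T} {T'} {x} x∉M m = record
    { inside-A      = λ y∈ → inside-A m (subst (_ ∈_) (toggle-∩-∉ x∉M) y∈)
    ; same-outside  = begin
        toggle x T' ─ M     ≡⟨ toggle-─-∉ x∉M ⟩
        toggle x (T' ─ M)   ≡⟨ cong (toggle x) (same-outside m) ⟩
        toggle x (T ─ M)    ≡⟨ ≡-sym (toggle-─-∉ x∉M) ⟩
        toggle x T ─ M      ∎
    ; same-count-in = begin
        ∣ toggle x T' ∩ M ∣ ≡⟨ cong ∣_∣ (toggle-∩-∉ {T = T'} x∉M) ⟩
        ∣ T' ∩ M ∣          ≡⟨ same-count-in m ⟩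
        ∣ T ∩ M ∣           ≡⟨ cong ∣_∣ (≡-sym (toggle-∩-∉ {T = T} x∉M)) ⟩
        ∣ toggle x T ∩ M ∣  ∎
    }
    where open ≡-Reasoning

  matches-toggle-∈ : ∀ {T T' x a} → x ∈ M → a ∈ M → a ∈ A →
                     (a ∈ T' ∩ M × x ∈ T ∩ M) ⊎ (a ∉ T' ∩ M × x ∉ T ∩ M) →
                     Matches M A T T' → Matches M A (toggle x T) (toggle a T')
  matches-toggle-∈ {T} {T'} {x} {a} x∈M a∈M a∈A same-kind m = record
    { inside-A      = λ y∈ → toggle-⊆ a∈A (inside-A m) (subst (_ ∈_) (toggle-∩-∈ a∈M) y∈)
    ; same-outside  = begin
        toggle a T' ─ M       ≡⟨ toggle-─-∈ a∈M ⟩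
        T' ─ M                ≡⟨ same-outside m ⟩
        T ─ M                 ≡⟨ ≡-sym (toggle-─-∈ x∈M) ⟩
        toggle x T ─ M        ∎
    ; same-count-in = begin
        ∣ toggle a T' ∩ M ∣   ≡⟨ cong ∣_∣ (toggle-∩-∈ {T = T'} a∈M) ⟩
        ∣ toggle a (T' ∩ M) ∣ ≡⟨ toggle-card-cong (same-count-in m) same-kind ⟩
        ∣ toggle x (T ∩ M) ∣  ≡⟨ cong ∣_∣ (≡-sym (toggle-∩-∈ {T = T} x∈M)) ⟩
        ∣ toggle x T ∩ M ∣    ∎
    }
    where open ≡-Reasoning

  matching-removal : ∀ {T T' x} → x ∈ M → x ∈ T ∩ M → Matches M A T T' →
                     ∃ λ a → Matches M A (toggle x T) (toggle a T')
  matching-removal {T} {T'} x∈M x∈T∩M m =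
    let (a , a∈T'∩M) = nonempty-transfer (≡-sym (same-count-in m)) x∈T∩M
    in a , matches-toggle-∈ x∈M (proj₂ (x∈p∩q⁻ T' M a∈T'∩M)) (inside-A m a∈T'∩M)
                            (inj₁ (a∈T'∩M , x∈T∩M)) m

  matches-threshold : ∀ {T T' k} → Matches M A T T' → k ≤ℤ + ∣ T ∣ → k ≤ℤ + ∣ T' ∣
  matches-threshold {k = k} m = subst (λ t → k ≤ℤ + t) (≡-sym (matches-size m))

module Simulation {n} (G : Graph n) (M A : Subset n) (u : Fin n)
  (module-M : IsModule G M) (indep-A : Independent G A) (A⊆M : A ⊆ M)
  (α-A : IsAlpha (induced G M) ∣ A ∣) (u∈M : u ∈ M) (u∉A : u ∉ A) where
  open Matches
  open Matching

  -- A set matching an independent set of G is independent in G - u: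
  -- inside M it lies in A ∌ u, outside M it lies in T, and an edge
  -- between the two parts would, M being a module, give an edge of T.
  matches-independent : ∀ {T T'} → Independent G T → Matches M A T T' →
                        Independent (delete G u) T'
  matches-independent {T} {T'} (T⊆V , noEdge-T) m = T'⊆V' , noEdge-T'
    where
    T'⊆V' : T' ⊆ V G - u
    T'⊆V' {y} y∈T' with y ∈? M
    ... | yes y∈M = x∈p∧x≢y⇒x∈p-y (proj₁ indep-A y∈A) λ { refl → u∉A y∈A }
      where y∈A = matches-∈ m y∈T' y∈M
    ... | no  y∉M = x∈p∧x≢y⇒x∈p-y (T⊆V (matches-∉ m y∈T' y∉M)) λ { refl → y∉M u∈M }
    no-cross-edge : ∀ {y z} → y ∈ T' → z ∈ T' → y ∈ M → z ∉ M → ¬ Edge G y z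
    no-cross-edge y∈T' z∈T' y∈M z∉M e =
      let (v , v∈T∩M) = nonempty-transfer (same-count-in m) (x∈p∩q⁺ (y∈T' , y∈M))
          (v∈T , v∈M) = x∈p∩q⁻ T M v∈T∩M
          z∈T         = matches-∉ m z∈T' z∉M
      in noEdge-T v∈T z∈T (proj₂ module-M y∈M v∈M (T⊆V z∈T) z∉M e)
    noEdge-T' : ∀ {y z} → y ∈ T' → z ∈ T' → ¬ Edge (delete G u) y z
    noEdge-T' {y} {z} y∈T' z∈T' e with y ∈? M | z ∈? M
    ... | yes y∈M | yes z∈M = proj₂ indep-A (matches-∈ m y∈T' y∈M) (matches-∈ m z∈T' z∈M)
                                            (delete-edge G u e)
    ... | no  y∉M | no  z∉M = noEdge-T (matches-∉ m y∈T' y∉M) (matches-∉ m z∈T' z∉M)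
                                       (delete-edge G u e)
    ... | yes y∈M | no  z∉M = no-cross-edge y∈T' z∈T' y∈M z∉M (delete-edge G u e)
    ... | no  y∉M | yes z∈M = no-cross-edge z∈T' y∈T' z∈M y∉M (edge-sym G (delete-edge G u e))

  -- x joins T ∩ M: the result is independent in G[M], so T' ∩ M is
  -- smaller than α(G[M]) = ∣ A ∣ and some vertex of A can join T'.
  matching-addition : ∀ {T T' x} → Matches M A T T' → Independent G (toggle x T) →
                      x ∈ M → x ∉ T ∩ M → ∃ λ a → Matches M A (toggle x T) (toggle a T')
  matching-addition {T} {T'} {x} m indep-xT x∈M x∉T∩M =
    let (a , a∈A , a∉T'∩M) = missing-element ∣T'∩M∣<∣A∣
    in a , matches-toggle-∈ x∈M (A⊆M a∈A) a∈A (inj₂ (a∉T'∩M , x∉T∩M)) m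
    where
    open ≤-Reasoning
    ∣T'∩M∣<∣A∣ : ∣ T' ∩ M ∣ < ∣ A ∣
    ∣T'∩M∣<∣A∣ = begin
      suc ∣ T' ∩ M ∣       ≡⟨ cong suc (same-count-in m) ⟩
      suc ∣ T ∩ M ∣        ≡⟨ ≡-sym (toggle-card-∉ x∉T∩M) ⟩
      ∣ toggle x (T ∩ M) ∣ ≡⟨ cong ∣_∣ (≡-sym (toggle-∩-∈ {T = T} x∈M)) ⟩
      ∣ toggle x T ∩ M ∣   ≤⟨ proj₂ α-A _ (induced-independent G M indep-xT) ⟩
      ∣ A ∣                ∎

  matching-toggle : ∀ {T T' x} → Matches M A T T' → Independent G (toggle x T) →
                    ∃ λ a → Matches M A (toggle x T) (toggle a T')
  matching-toggle {T} {T'} {x} m indep-xT with x ∈? M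
  ... | no  x∉M = x , matches-toggle-∉ x∉M m
  ... | yes x∈M with x ∈? T
  ... | yes x∈T = matching-removal x∈M (x∈p∩q⁺ (x∈T , x∈M)) m
  ... | no  x∉T = matching-addition m indep-xT x∈M (λ x∈T∩M → x∉T (proj₁ (x∈p∩q⁻ T M x∈T∩M)))

  simulate : ∀ {S T k} → S ∩ M ⊆ A → Reach G k S T →
             ∃ λ T' → Reach (delete G u) k S T' × Matches M A T T'
  simulate S∩M⊆A here = _ , here , matches-refl S∩M⊆A
  simulate S∩M⊆A (step {T} r (iT , iT₂ , sd , k≤T , k≤T₂))
    with simulate S∩M⊆A r | single-toggle T _ sd
  ... | T' , r' , m | inj₁ refl = T' , r' , m
  ... | T' , r' , m | inj₂ (x , refl) =
    let (a , m₂) = matching-toggle m iT₂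
    in toggle a T' ,
       step r' ( matches-independent iT m , matches-independent iT₂ m₂
               , ≤-reflexive (symDiff-toggle a T')
               , matches-threshold m k≤T , matches-threshold m₂ k≤T₂ ) ,
       m₂

  counterpart : ∀ {S T k} → S ∩ M ⊆ A → Independent G T → Reach G k S T →
                ∃ λ T' → Independent (delete G u) T' × Reach (delete G u) k S T' × ∣ T' ∣ ≡ ∣ T ∣
  counterpart S∩M⊆A iT r =
    let (T' , r' , m) = simulate S∩M⊆A r
    in T' , matches-independent iT m , r' , matches-size m

-- λ(G,S,k) = λ(G - u,S,k).
lemma2 : ∀ {n : ℕ} (G : Graph n) (S : Subset n) (k : ℤ) (M : Subset n) →
    Independent G S → IsModule G M →
    (A : Subset n) → Independent G A → A ⊆ M → (S ∩ M) ⊆ A →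
    IsAlpha (induced G M) ∣ A ∣ →
    (u : Fin n) → u ∈ M → u ∉ A →
    (m : ℕ) → IsLambda G S k m ⇔ IsLambda (delete G u) S k m
lemma2 G S k M _ module-M A indep-A A⊆M S∩M⊆A α-A u u∈M u∉A m =
  lambda-transfer G (delete G u) S k m
    (λ iT r → delete-independent G u iT , delete-reach G u r)
    (counterpart S∩M⊆A)
  where open Simulation G M A u module-M indep-A A⊆M α-A u∈M u∉A
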